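{- Let $K$ be a real quadratic field with fundamental unit $\epsilon>1$. For each $y\ge1$, the number of primes $p$ inert in $K$ with $\ell(p)\le y$ is $O(y^2)$, with implied constant depending only on $K$.
   Context: For a positive integer $f$, $\ell(f)$ is the order of the image of $\epsilon$ in $(\mathcal{O}_K/f\mathcal{O}_K)^\times/\langle\text{images of integers coprime to } f\rangle$; equivalently, the least positive integer $\ell$ with $\epsilon^\ell\in\mathbb{Z}+f\mathcal{O}_K$. -}

module Defs where

open import Data.Nat as ℕ using (ℕ; _≡ᵇ_; _%_; _∸_)
open import Data.Nat.Primality using (Prime)
open import Data.Integer using (ℤ; +_; _+_; _-_; _*_; -_; _<_; _≤_)
open import Data.Bool using (if_then_else_)
open import Data.Product using (Σ; _×_; _,_; ∃; ∃-syntax; proj₁; proj₂)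
open import Data.Sum using (_⊎_)
open import Relation.Binary.PropositionalEquality using (_≡_)
open import Relation.Nullary using (¬_)

SquareFree : ℕ → Set
SquareFree d = ∀ (m : ℕ) → (m ℕ.* m) Data.Nat.Divisibility.∣ d → m ≡ 1
  where import Data.Nat.Divisibility

-- O_K = ℤ[ω] with ω² = t·ω + n, where
--   ω = √d,        (t , n) = (0 , d)          if d ≢ 1 mod 4,
--   ω = (1+√d)/2,  (t , n) = (1 , (d-1)/4)    if d ≡ 1 mod 4.
ωt : ℕ → ℤ
ωt d = if (d % 4) ≡ᵇ 1 then + 1 else + 0

ωn : ℕ → ℤ
ωn d = if (d % 4) ≡ᵇ 1 then + ((d ∸ 1) ℕ./ 4) else + d

-- An element a + b ω of O_K is represented by the pair (a , b).
OK : Set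
OK = ℤ × ℤ

re im : OK → ℤ
re = proj₁
im = proj₂

oneK : OK
oneK = (+ 1 , + 0)

negK : OK → OK
negK (a , b) = (- a , - b)

mulK : ℕ → OK → OK → OK
mulK d (a , b) (c , e) =
  (a * c + ωn d * (b * e) , a * e + b * c + ωt d * (b * e))

powK : ℕ → OK → ℕ → OK
powK d x ℕ.zero = oneK
powK d x (ℕ.suc k) = mulK d x (powK d x k)

IsUnit : ℕ → OK → Set
IsUnit d u = ∃[ v ] mulK d u v ≡ oneK

-- x + y √d > 0 (real number, via the embedding √d > 0), for x y ∈ ℤ, d > 1 squarefree
PosSqrt : ℕ → ℤ → ℤ → Set
PosSqrt d x y =
  ((+ d) * (y * y) < x * x × + 0 < x) ⊎ (x * x < (+ d) * (y * y) × + 0 < y)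

-- a + b ω > 1 as a real number, where 2(a + bω) = (2a + t b) + b √d.
GtOne : ℕ → OK → Set
GtOne d (a , b) = PosSqrt d (+ 2 * a + ωt d * b - + 2) b

-- ε is the fundamental unit > 1: a unit, ε > 1, and every unit is ± ε^k, k ∈ ℤ.
IsFundamentalUnit : ℕ → OK → Set
IsFundamentalUnit d ε =
  IsUnit d ε × GtOne d ε ×
  (∀ (u : OK) → IsUnit d u → ∃[ k ]
     ( u ≡ powK d ε k ⊎ u ≡ negK (powK d ε k)
     ⊎ mulK d u (powK d ε k) ≡ oneK ⊎ mulK d u (powK d ε k) ≡ negK oneK))

InZplusfOK : ℕ → ℕ → OK → Set
InZplusfOK d f α = ∃[ m ] ∃[ γ ] α ≡ (m + (+ f) * re γ , (+ f) * im γ)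

IsEll : ℕ → OK → ℕ → ℕ → Set
IsEll d ε f ℓ =
  1 ℕ.≤ ℓ × InZplusfOK d f (powK d ε ℓ) ×
  (∀ (k : ℕ) → 1 ℕ.≤ k → InZplusfOK d f (powK d ε k) → ℓ ℕ.≤ k)

EllAtMost : ℕ → OK → ℕ → ℕ → Set
EllAtMost d ε f y = ∃[ ℓ ] IsEll d ε f ℓ × ℓ ℕ.≤ y

DividesK : ℕ → ℕ → OK → Set
DividesK d f α = ∃[ γ ] α ≡ ((+ f) * re γ , (+ f) * im γ)

-- p is inert in K: p is a prime number and p O_K is a prime ideal of O_K
Inert : ℕ → ℕ → Set
Inert d p =
  Prime p × ¬ DividesK d p oneK ×
  (∀ (α β : OK) → DividesK d p (mulK d α β) → DividesK d p α ⊎ DividesK d p β)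

{-# OPTIONS --safe #-}
module Submission where

-- Write εᵏ = xₖ + yₖω. The ω-coordinates form a Lucas sequence yₖ₊₂ = T yₖ₊₁ − N yₖ with
-- y₀ = 0 and y₁ = b, where T and N = ±1 are the trace and norm of ε = a + bω. If εˡ ∈ ℤ + pO_K
-- then p ∣ yₗ, so every prime with ℓ(p) ≤ y divides P = |y₁ ⋯ y_y|. As ε > 1 forces b ≠ 0, we
-- get T² − 4N = D b² ≥ 5, hence |T² − 2N| ≥ 2; then yₖ₊₄ + yₖ = (T² − 2N) yₖ₊₂ makes |yₖ| grow
-- strictly every two steps, so P ≠ 0. With |yₖ| ≤ Kᵏ we get P ≤ K^(y²), and a nonzero P has at
-- most log₂ P ≤ K y² distinct prime factors.

open import Defs
open import Data.Nat.Base as ℕ using (ℕ; zero; suc; z≤n; s≤s)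
import Data.Nat.Properties as ℕ
open import Data.Nat.DivMod as ℕ using ()
open import Data.Nat.Divisibility as ℕ using ()
open import Data.Integer.Base as ℤ using (ℤ; +_; +[1+_]; -[1+_]; ∣_∣)
import Data.Integer.Properties as ℤ
open import Data.Product using (_×_; _,_; ∃-syntax)
open import Data.Empty using (⊥-elim)
open import Data.Sum using (_⊎_; inj₁; inj₂)
open import Data.Bool.Base using (true; false; if_then_else_)
open import Relation.Nullary using (¬_)
open import Data.Integer.Tactic.RingSolver using (solve-∀)
open import Relation.Binary.PropositionalEquality
  using (_≡_; refl; sym; trans; cong; cong₂; subst; module ≡-Reasoning)

i*i≡+∣i∣*∣i∣ : ∀ i → i ℤ.* i ≡ + (∣ i ∣ ℕ.* ∣ i ∣)
i*i≡+∣i∣*∣i∣ (+ n)    = ℤ.+◃n≡+n (n ℕ.* n)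
i*i≡+∣i∣*∣i∣ -[1+ n ] = ℤ.+◃n≡+n (suc n ℕ.* suc n)

1≤m*n⇒1≤m : ∀ m {n} → 1 ℕ.≤ m ℕ.* n → 1 ℕ.≤ m
1≤m*n⇒1≤m (suc _) _ = s≤s z≤n

n+n≡2*n : ∀ n → n ℕ.+ n ≡ 2 ℕ.* n
n+n≡2*n n = cong (n ℕ.+_) (sym (ℕ.+-identityʳ n))

square-discriminant-bounds : ∀ {S m} Q → ∣ Q ∣ ≡ 1 → + S ℤ.- + 4 ℤ.* Q ≡ + m → 5 ℕ.≤ m →
  1 ℕ.≤ S × 2 ℕ.≤ ∣ + S ℤ.- Q ∣ × 2 ℕ.≤ ∣ + S ℤ.- Q ℤ.- Q ∣
square-discriminant-bounds {S} {m} (+ .1) refl disc _ = bounds S≡4+m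
  where
  sub-add : ∀ i j → i ≡ i ℤ.- j ℤ.* + 1 ℤ.+ j
  sub-add = solve-∀
  S≡4+m : S ≡ 4 ℕ.+ m
  S≡4+m = trans (ℤ.+-injective (trans (sub-add (+ S) (+ 4)) (cong (ℤ._+ + 4) disc))) (ℕ.+-comm m 4)
  bounds : S ≡ 4 ℕ.+ m → 1 ℕ.≤ S × 2 ℕ.≤ ∣ + S ℤ.- + 1 ∣ × 2 ℕ.≤ ∣ + S ℤ.- + 1 ℤ.- + 1 ∣
  bounds refl = s≤s z≤n , s≤s (s≤s z≤n) , s≤s (s≤s z≤n)
square-discriminant-bounds {zero} -[1+ 0 ] refl disc 5≤m =
  ⊥-elim (ℕ.<⇒≱ 5≤m (ℕ.≤-reflexive (ℤ.+-injective (sym disc))))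
square-discriminant-bounds {suc S} -[1+ 0 ] refl _ _ =
  s≤s z≤n , s≤s (ℕ.m≤n+m 1 S) , s≤s (ℕ.m≤n+m 1 (S ℕ.+ 1))

discriminant-bounds : ∀ {m} T Q → ∣ Q ∣ ≡ 1 → T ℤ.* T ℤ.- + 4 ℤ.* Q ≡ + m → 5 ℕ.≤ m →
  1 ℕ.≤ ∣ T ∣ × 2 ℕ.≤ ∣ T ℤ.* T ℤ.- Q ∣ × 2 ℕ.≤ ∣ T ℤ.* T ℤ.- Q ℤ.- Q ∣
discriminant-bounds T Q ∣Q∣≡1 disc 5≤m rewrite i*i≡+∣i∣*∣i∣ T
  with 1≤T² , bound₁ , bound₂ ← square-discriminant-bounds Q ∣Q∣≡1 disc 5≤m
  = 1≤m*n⇒1≤m ∣ T ∣ 1≤T² , bound₁ , bound₂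

module LucasSequence (T N : ℤ) (z : ℕ → ℤ) (z₀≡0 : z 0 ≡ + 0)
  (z-rec : ∀ k → z (2 ℕ.+ k) ≡ T ℤ.* z (1 ℕ.+ k) ℤ.- N ℤ.* z k) where

  open import Data.Integer.Base using (_+_; _-_; _*_)

  z₂≡T*z₁ : z 2 ≡ T * z 1
  z₂≡T*z₁ = begin
    z 2                 ≡⟨ z-rec 0 ⟩
    T * z 1 - N * z 0   ≡⟨ cong (λ z₀ → T * z 1 - N * z₀) z₀≡0 ⟩
    T * z 1 - N * + 0   ≡⟨ x-y*0≡x (T * z 1) N ⟩
    T * z 1             ∎
    where
    open ≡-Reasoning
    x-y*0≡x : ∀ x y → x - y * + 0 ≡ x
    x-y*0≡x = solve-∀

  z₃≡[T*T-N]*z₁ : z 3 ≡ (T * T - N) * z 1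
  z₃≡[T*T-N]*z₁ = begin
    z 3                      ≡⟨ z-rec 1 ⟩
    T * z 2 - N * z 1        ≡⟨ cong (λ z₂ → T * z₂ - N * z 1) z₂≡T*z₁ ⟩
    T * (T * z 1) - N * z 1  ≡⟨ distrib T N (z 1) ⟩
    (T * T - N) * z 1        ∎
    where
    open ≡-Reasoning
    distrib : ∀ t n x → t * (t * x) - n * x ≡ (t * t - n) * x
    distrib = solve-∀

  z-rec₂ : ∀ k → z (4 ℕ.+ k) + N * (N * z k) ≡ (T * T - N - N) * z (2 ℕ.+ k)
  z-rec₂ k = twoSteps (z-rec k) (z-rec (1 ℕ.+ k)) (z-rec (2 ℕ.+ k))
    where
    identity : ∀ t n a b →
      t * (t * (t * b - n * a) - n * b) - n * (t * b - n * a) + n * (n * a)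
        ≡ (t * t - n - n) * (t * b - n * a)
    identity = solve-∀
    twoSteps : ∀ {a b c d e} → c ≡ T * b - N * a → d ≡ T * c - N * b → e ≡ T * d - N * c →
               e + N * (N * a) ≡ (T * T - N - N) * c
    twoSteps {a} {b} refl refl refl = identity T N a b

  module _ (∣N∣≡1 : ∣ N ∣ ≡ 1) where

    ∣N*i∣≡∣i∣ : ∀ i → ∣ N * i ∣ ≡ ∣ i ∣
    ∣N*i∣≡∣i∣ i = trans (ℤ.abs-* N i) (trans (cong (ℕ._* ∣ i ∣) ∣N∣≡1) (ℕ.*-identityˡ ∣ i ∣))

    ∣z∣-rec-≤ : ∀ k → ∣ z (2 ℕ.+ k) ∣ ℕ.≤ ∣ T ∣ ℕ.* ∣ z (1 ℕ.+ k) ∣ ℕ.+ ∣ z k ∣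
    ∣z∣-rec-≤ k = begin
      ∣ z (2 ℕ.+ k) ∣                              ≡⟨ cong ∣_∣ (z-rec k) ⟩
      ∣ T * z (1 ℕ.+ k) - N * z k ∣                ≤⟨ ℤ.∣i-j∣≤∣i∣+∣j∣ (T * z (1 ℕ.+ k)) (N * z k) ⟩
      ∣ T * z (1 ℕ.+ k) ∣ ℕ.+ ∣ N * z k ∣          ≡⟨ cong₂ ℕ._+_ (ℤ.abs-* T (z (1 ℕ.+ k))) (∣N*i∣≡∣i∣ (z k)) ⟩
      ∣ T ∣ ℕ.* ∣ z (1 ℕ.+ k) ∣ ℕ.+ ∣ z k ∣        ∎
      where open ℕ.≤-Reasoning

    ∣z∣≤^ : ∀ {K} → suc ∣ T ∣ ℕ.≤ K → ∣ z 1 ∣ ℕ.≤ K → ∀ k → ∣ z k ∣ ℕ.≤ K ℕ.^ k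
    ∣z∣≤^ {suc K} (s≤s ∣T∣≤K) ∣z₁∣≤1+K = bound
      where
      bound : ∀ k → ∣ z k ∣ ℕ.≤ suc K ℕ.^ k
      bound zero          = subst (λ z₀ → ∣ z₀ ∣ ℕ.≤ 1) (sym z₀≡0) z≤n
      bound (suc zero)    = subst (∣ z 1 ∣ ℕ.≤_) (sym (ℕ.*-identityʳ (suc K))) ∣z₁∣≤1+K
      bound (suc (suc k)) = begin
        ∣ z (2 ℕ.+ k) ∣                            ≤⟨ ∣z∣-rec-≤ k ⟩
        ∣ T ∣ ℕ.* ∣ z (1 ℕ.+ k) ∣ ℕ.+ ∣ z k ∣      ≤⟨ ℕ.+-mono-≤ (ℕ.*-mono-≤ ∣T∣≤K (bound (suc k)))
                                                                 (ℕ.≤-trans (bound k) (ℕ.m≤n*m _ (suc K))) ⟩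
        K ℕ.* (suc K ℕ.^ suc k) ℕ.+ suc K ℕ.^ suc k  ≡⟨ ℕ.+-comm (K ℕ.* _) _ ⟩
        suc K ℕ.^ (2 ℕ.+ k)                         ∎
        where open ℕ.≤-Reasoning

    module _ (1≤∣T∣ : 1 ℕ.≤ ∣ T ∣) (2≤∣T*T-N∣ : 2 ℕ.≤ ∣ T * T - N ∣)
             (2≤∣T*T-N-N∣ : 2 ℕ.≤ ∣ T * T - N - N ∣) (1≤∣z₁∣ : 1 ℕ.≤ ∣ z 1 ∣) where

      ∣z∣-increasing₂ : ∀ k → ∣ z k ∣ ℕ.< ∣ z (2 ℕ.+ k) ∣
      ∣z∣-increasing₂ zero = begin-strict
        ∣ z 0 ∣            ≡⟨ cong ∣_∣ z₀≡0 ⟩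
        0                  <⟨ ℕ.*-mono-≤ 1≤∣T∣ 1≤∣z₁∣ ⟩
        ∣ T ∣ ℕ.* ∣ z 1 ∣  ≡⟨ ℤ.abs-* T (z 1) ⟨
        ∣ T * z 1 ∣        ≡⟨ cong ∣_∣ z₂≡T*z₁ ⟨
        ∣ z 2 ∣            ∎
        where open ℕ.≤-Reasoning
      ∣z∣-increasing₂ (suc zero) = begin-strict
        ∣ z 1 ∣                        <⟨ ℕ.m<m+n ∣ z 1 ∣ 1≤∣z₁∣ ⟩
        ∣ z 1 ∣ ℕ.+ ∣ z 1 ∣            ≡⟨ n+n≡2*n ∣ z 1 ∣ ⟩
        2 ℕ.* ∣ z 1 ∣                  ≤⟨ ℕ.*-monoˡ-≤ ∣ z 1 ∣ 2≤∣T*T-N∣ ⟩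
        ∣ T * T - N ∣ ℕ.* ∣ z 1 ∣      ≡⟨ ℤ.abs-* (T * T - N) (z 1) ⟨
        ∣ (T * T - N) * z 1 ∣          ≡⟨ cong ∣_∣ z₃≡[T*T-N]*z₁ ⟨
        ∣ z 3 ∣                        ∎
        where open ℕ.≤-Reasoning
      ∣z∣-increasing₂ (suc (suc k)) = ℕ.+-cancelʳ-< _ _ _ (begin-strict
        ∣ z (2 ℕ.+ k) ∣ ℕ.+ ∣ z (2 ℕ.+ k) ∣            ≡⟨ n+n≡2*n ∣ z (2 ℕ.+ k) ∣ ⟩
        2 ℕ.* ∣ z (2 ℕ.+ k) ∣                          ≤⟨ ℕ.*-monoˡ-≤ ∣ z (2 ℕ.+ k) ∣ 2≤∣T*T-N-N∣ ⟩
        ∣ T * T - N - N ∣ ℕ.* ∣ z (2 ℕ.+ k) ∣          ≡⟨ ℤ.abs-* (T * T - N - N) (z (2 ℕ.+ k)) ⟨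
        ∣ (T * T - N - N) * z (2 ℕ.+ k) ∣              ≡⟨ cong ∣_∣ (z-rec₂ k) ⟨
        ∣ z (4 ℕ.+ k) + N * (N * z k) ∣                ≤⟨ ℤ.∣i+j∣≤∣i∣+∣j∣ (z (4 ℕ.+ k)) (N * (N * z k)) ⟩
        ∣ z (4 ℕ.+ k) ∣ ℕ.+ ∣ N * (N * z k) ∣          ≡⟨ cong (∣ z (4 ℕ.+ k) ∣ ℕ.+_) (trans (∣N*i∣≡∣i∣ _) (∣N*i∣≡∣i∣ _)) ⟩
        ∣ z (4 ℕ.+ k) ∣ ℕ.+ ∣ z k ∣                    <⟨ ℕ.+-monoʳ-< ∣ z (4 ℕ.+ k) ∣ (∣z∣-increasing₂ k) ⟩
        ∣ z (4 ℕ.+ k) ∣ ℕ.+ ∣ z (2 ℕ.+ k) ∣            ∎)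
        where open ℕ.≤-Reasoning

      ∣z[1+k]∣>0 : ∀ k → 0 ℕ.< ∣ z (suc k) ∣
      ∣z[1+k]∣>0 zero    = 1≤∣z₁∣
      ∣z[1+k]∣>0 (suc k) = ℕ.≤-<-trans z≤n (∣z∣-increasing₂ k)

d≡1mod4⇒5≤d : ∀ {d} → 1 ℕ.< d → (d ℕ.% 4 ℕ.≡ᵇ 1) ≡ true → 5 ℕ.≤ d
d≡1mod4⇒5≤d {suc (suc (suc (suc (suc _))))} _ _ = s≤s (s≤s (s≤s (s≤s (s≤s z≤n))))
d≡1mod4⇒5≤d {1} (s≤s ()) _
d≡1mod4⇒5≤d {2} _ ()
d≡1mod4⇒5≤d {3} _ ()
d≡1mod4⇒5≤d {4} _ ()

∣i∣≡1⇒i≡±1 : ∀ {i} → ∣ i ∣ ≡ 1 → i ≡ + 1 ⊎ i ≡ -[1+ 0 ]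
∣i∣≡1⇒i≡±1 {+ .1}      refl = inj₁ refl
∣i∣≡1⇒i≡±1 { -[1+ 0 ]} refl = inj₂ refl

module QuadraticOrder (d : ℕ) where

  open import Data.Integer.Base using (_+_; _-_; _*_; _<_; +<+)

  normK : OK → ℤ
  normK (a , b) = a * a + ωt d * a * b - ωn d * (b * b)

  traceK : OK → ℤ
  traceK (a , b) = + 2 * a + ωt d * b

  normK-mulK : ∀ x y → normK (mulK d x y) ≡ normK x * normK y
  normK-mulK (a , b) (c , e) = multiplicative a b c e (ωt d) (ωn d)
    where
    multiplicative : ∀ a b c e t n →
      (a * c + n * (b * e)) * (a * c + n * (b * e))
      + t * (a * c + n * (b * e)) * (a * e + b * c + t * (b * e))
      - n * ((a * e + b * c + t * (b * e)) * (a * e + b * c + t * (b * e)))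
      ≡ (a * a + t * a * b - n * (b * b)) * (c * c + t * c * e - n * (e * e))
    multiplicative = solve-∀

  normK-oneK : normK oneK ≡ + 1
  normK-oneK = one (ωt d) (ωn d)
    where
    one : ∀ t n → + 1 * + 1 + t * + 1 * + 0 - n * (+ 0 * + 0) ≡ + 1
    one = solve-∀

  unit⇒∣normK∣≡1 : ∀ x → IsUnit d x → ∣ normK x ∣ ≡ 1
  unit⇒∣normK∣≡1 x (y , xy≡1) = ℕ.m*n≡1⇒m≡1 ∣ normK x ∣ ∣ normK y ∣ (begin
    ∣ normK x ∣ ℕ.* ∣ normK y ∣  ≡⟨ ℤ.abs-* (normK x) (normK y) ⟨
    ∣ normK x * normK y ∣        ≡⟨ cong ∣_∣ (normK-mulK x y) ⟨
    ∣ normK (mulK d x y) ∣       ≡⟨ cong (λ xy → ∣ normK xy ∣) xy≡1 ⟩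
    ∣ normK oneK ∣               ≡⟨ cong ∣_∣ normK-oneK ⟩
    1                            ∎)
    where open ≡-Reasoning

  im-powK-1 : ∀ x → im (powK d x 1) ≡ im x
  im-powK-1 (a , b) = identity a b (ωt d)
    where
    identity : ∀ a b t → a * + 0 + b * + 1 + t * (b * + 0) ≡ b
    identity = solve-∀

  im-powK-rec : ∀ x k → im (powK d x (2 ℕ.+ k)) ≡ traceK x * im (powK d x (1 ℕ.+ k)) - normK x * im (powK d x k)
  im-powK-rec (a , b) k = cayley-hamilton a b (ωt d) (ωn d) (re (powK d (a , b) k)) (im (powK d (a , b) k))
    where
    cayley-hamilton : ∀ a b t n p q →
      a * (a * q + b * p + t * (b * q)) + b * (a * p + n * (b * q)) + t * (b * (a * q + b * p + t * (b * q)))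
        ≡ (+ 2 * a + t * b) * (a * q + b * p + t * (b * q)) - (a * a + t * a * b - n * (b * b)) * q
    cayley-hamilton = solve-∀

  traceK²-4normK : ∀ x → traceK x * traceK x - + 4 * normK x ≡ (ωt d * ωt d + + 4 * ωn d) * (im x * im x)
  traceK²-4normK (a , b) = identity a b (ωt d) (ωn d)
    where
    identity : ∀ a b t n →
      (+ 2 * a + t * b) * (+ 2 * a + t * b) - + 4 * (a * a + t * a * b - n * (b * b)) ≡ (t * t + + 4 * n) * (b * b)
    identity = solve-∀

  -- t² + 4n is the discriminant of K, namely d or 4d.
  discriminantK≥5 : 1 ℕ.< d → ∃[ D ] 5 ℕ.≤ D × ωt d * ωt d + + 4 * ωn d ≡ + D
  discriminantK≥5 1<d = by-residue (d ℕ.% 4 ℕ.≡ᵇ 1) refl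
    where
    by-residue : ∀ c → (d ℕ.% 4 ℕ.≡ᵇ 1) ≡ c → ∃[ D ] 5 ℕ.≤ D ×
      (if c then + 1 else + 0) * (if c then + 1 else + 0) + + 4 * (if c then + ((d ℕ.∸ 1) ℕ./ 4) else + d) ≡ + D
    by-residue false _ = 4 ℕ.* d , ℕ.≤-trans (ℕ.m≤m+n 5 3) (ℕ.*-monoʳ-≤ 4 1<d) , cong (_+_ (+ 0)) (ℤ.+◃n≡+n (4 ℕ.* d))
    by-residue true d≡1 =
      1 ℕ.+ 4 ℕ.* q , s≤s (ℕ.*-monoʳ-≤ 4 1≤q) , cong (_+_ (+ 1)) (ℤ.+◃n≡+n (4 ℕ.* q))
      where
      q = (d ℕ.∸ 1) ℕ./ 4
      1≤q : 1 ℕ.≤ q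
      1≤q = ℕ.m≥n⇒m/n>0 (ℕ.∸-monoˡ-≤ 1 (d≡1mod4⇒5≤d 1<d d≡1))

  unit>1⇒1≤∣im∣ : ∀ x → IsUnit d x → GtOne d x → 1 ℕ.≤ ∣ im x ∣
  unit>1⇒1≤∣im∣ (_ , +[1+ _ ]) _ _ = s≤s z≤n
  unit>1⇒1≤∣im∣ (_ , -[1+ _ ]) _ _ = s≤s z≤n
  unit>1⇒1≤∣im∣ (_ , + 0) _ (inj₂ (_ , +<+ ()))
  unit>1⇒1≤∣im∣ (a , + 0) unit (inj₁ (_ , 0<2a+t*0-2)) =
    ⊥-elim (a≢±1 (∣i∣≡1⇒i≡±1 ∣a∣≡1) (subst (+ 0 <_) (drop-im (ωt d) a) 0<2a+t*0-2))
    where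
    drop-im : ∀ t a → + 2 * a + t * + 0 - + 2 ≡ + 2 * a - + 2
    drop-im = solve-∀
    normK-rational : ∀ t n a → a * a + t * a * + 0 - n * (+ 0 * + 0) ≡ a * a
    normK-rational = solve-∀
    ∣a∣≡1 : ∣ a ∣ ≡ 1
    ∣a∣≡1 = ℕ.m*n≡1⇒m≡1 ∣ a ∣ ∣ a ∣ (trans (sym (ℤ.abs-* a a))
              (trans (cong ∣_∣ (sym (normK-rational (ωt d) (ωn d) a))) (unit⇒∣normK∣≡1 (a , + 0) unit)))
    a≢±1 : a ≡ + 1 ⊎ a ≡ -[1+ 0 ] → ¬ (+ 0 < + 2 * a - + 2)
    a≢±1 (inj₁ refl) (+<+ ())
    a≢±1 (inj₂ refl) ()

  traceK²-4normK≥5 : 1 ℕ.< d → ∀ x → 1 ℕ.≤ ∣ im x ∣ →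
    ∃[ m ] 5 ℕ.≤ m × traceK x * traceK x - + 4 * normK x ≡ + m
  traceK²-4normK≥5 1<d x 1≤∣b∣ =
    let D , 5≤D , D≡t²+4n = discriminantK≥5 1<d
        β = ∣ im x ∣
    in D ℕ.* (β ℕ.* β) , ℕ.*-mono-≤ 5≤D (ℕ.*-mono-≤ 1≤∣b∣ 1≤∣b∣) , (begin
      traceK x * traceK x - + 4 * normK x           ≡⟨ traceK²-4normK x ⟩
      (ωt d * ωt d + + 4 * ωn d) * (im x * im x)    ≡⟨ cong₂ _*_ D≡t²+4n (i*i≡+∣i∣*∣i∣ (im x)) ⟩
      + D * + (β ℕ.* β)                             ≡⟨ ℤ.pos-* D (β ℕ.* β) ⟨
      + (D ℕ.* (β ℕ.* β))                           ∎)
    where open ≡-Reasoning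

  module _ (1<d : 1 ℕ.< d) (ε : OK) (ε-unit : IsUnit d ε) (ε>1 : GtOne d ε) where

    private
      z : ℕ → ℤ
      z k = im (powK d ε k)

      ∣N∣≡1 : ∣ normK ε ∣ ≡ 1
      ∣N∣≡1 = unit⇒∣normK∣≡1 ε ε-unit

      1≤∣b∣ : 1 ℕ.≤ ∣ im ε ∣
      1≤∣b∣ = unit>1⇒1≤∣im∣ ε ε-unit ε>1

      ∣z₁∣≡∣b∣ : ∣ z 1 ∣ ≡ ∣ im ε ∣
      ∣z₁∣≡∣b∣ = cong ∣_∣ (im-powK-1 ε)

    open LucasSequence (traceK ε) (normK ε) z refl (im-powK-rec ε)

    ∣im-powK∣>0 : ∀ k → 0 ℕ.< ∣ im (powK d ε (suc k)) ∣
    ∣im-powK∣>0 =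
      let _ , 5≤m , disc = traceK²-4normK≥5 1<d ε 1≤∣b∣
          1≤∣T∣ , 2≤∣T*T-N∣ , 2≤∣T*T-N-N∣ = discriminant-bounds (traceK ε) (normK ε) ∣N∣≡1 disc 5≤m
      in ∣z[1+k]∣>0 ∣N∣≡1 1≤∣T∣ 2≤∣T*T-N∣ 2≤∣T*T-N-N∣ (subst (1 ℕ.≤_) (sym ∣z₁∣≡∣b∣) 1≤∣b∣)

    ∣im-powK∣≤^ : ∀ k → ∣ im (powK d ε k) ∣ ℕ.≤ suc (∣ traceK ε ∣ ℕ.+ ∣ im ε ∣) ℕ.^ k
    ∣im-powK∣≤^ = ∣z∣≤^ ∣N∣≡1 (s≤s (ℕ.m≤m+n _ _))
      (subst (ℕ._≤ suc (∣ traceK ε ∣ ℕ.+ ∣ im ε ∣)) (sym ∣z₁∣≡∣b∣) (ℕ.m≤n⇒m≤1+n (ℕ.m≤n+m _ _)))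

  InZplusfOK⇒f∣∣im∣ : ∀ {f α} → InZplusfOK d f α → f ℕ.∣ ∣ im α ∣
  InZplusfOK⇒f∣∣im∣ {f} (_ , γ , refl) = ℕ.divides ∣ im γ ∣ (trans (ℤ.abs-* (+ f) (im γ)) (ℕ.*-comm f ∣ im γ ∣))

-- Opened only now: above, ℕ's arithmetic would clash with ℤ's inside the modules.
open import Data.Nat.Base using (_<_; _≤_; _*_; _^_; NonZero; >-nonZero; >-nonZero⁻¹; nonTrivial⇒n>1; z<s)
open import Data.Nat.Properties
  using (≤-refl; ≤-trans; ≤-reflexive; <⇒≤; <⇒≱; ≮⇒≥; *-comm; *-mono-≤; +-mono-≤; ^-monoˡ-≤; ^-monoʳ-≤; ^-monoʳ-<; ^-*-assoc; m^n>0; module ≤-Reasoning)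
open import Data.Nat.Divisibility using (_∣_; divides; ∣-trans)
open import Data.Nat.Primality using (Prime; euclidsLemma; prime⇒irreducible; prime⇒nonTrivial; ¬prime[1])
open import Data.Nat.ListAction using (product)
open import Data.Nat.ListAction.Properties using (∈⇒∣product; product≢0)
open import Data.List.Base using (List; []; _∷_; length; map; applyUpTo)
open import Data.List.Properties using (length-map; length-applyUpTo)
open import Data.List.Membership.Propositional.Properties using (∈-map⁺; ∈-applyUpTo⁺)
open import Data.List.Relation.Unary.All as All using (All; []; _∷_)
open import Data.List.Relation.Unary.All.Properties using (map⁺; applyUpTo⁺₁; applyUpTo⁺₂)
open import Data.List.Relation.Unary.AllPairs using (_∷_)
open import Data.List.Relation.Unary.Unique.Propositional using (Unique)
open import Relation.Binary.PropositionalEquality using (_≢_; ≢-sym)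

n<2^n : ∀ n → n < 2 ^ n
n<2^n zero    = z<s
n<2^n (suc n) = ≤-trans (+-mono-≤ (m^n>0 2 n) (n<2^n n)) (≤-reflexive (n+n≡2*n (2 ^ n)))

2^-cancel-≤ : ∀ {m n} → 2 ^ m ≤ 2 ^ n → m ≤ n
2^-cancel-≤ 2^m≤2^n = ≮⇒≥ (λ n<m → <⇒≱ (^-monoʳ-< 2 (s≤s (s≤s z≤n)) n<m) 2^m≤2^n)

product≤^length : ∀ {m ns} → All (_≤ m) ns → product ns ≤ m ^ length ns
product≤^length []           = ≤-refl
product≤^length (n≤m ∷ ns≤m) = *-mono-≤ n≤m (product≤^length ns≤m)

prime∣m*p⇒∣m : ∀ {m p r} → Prime p → Prime r → r ≢ p → r ∣ m * p → r ∣ m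
prime∣m*p⇒∣m {m} {p} p-prime r-prime r≢p r∣m*p with euclidsLemma m p r-prime r∣m*p
... | inj₁ r∣m = r∣m
... | inj₂ r∣p with prime⇒irreducible p-prime r∣p
...   | inj₁ r≡1 = ⊥-elim (¬prime[1] (subst Prime r≡1 r-prime))
...   | inj₂ r≡p = ⊥-elim (r≢p r≡p)

distinctPrimeDivisors⇒2^length≤ : ∀ {ps n} → 1 ≤ n → Unique ps → All (λ p → Prime p × p ∣ n) ps →
  2 ^ length ps ≤ n
distinctPrimeDivisors⇒2^length≤ {[]} 1≤n _ _ = 1≤n
distinctPrimeDivisors⇒2^length≤ {p ∷ ps} 1≤q*p (p∉ps ∷ unique) ((p-prime , divides q refl) ∷ ps∣q*p) = begin
  2 * 2 ^ length ps  ≤⟨ *-mono-≤ (nonTrivial⇒n>1 p {{prime⇒nonTrivial p-prime}}) 2^length≤q ⟩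
  p * q              ≡⟨ *-comm p q ⟩
  q * p              ∎
  where
  open ≤-Reasoning
  ps∣q : All (λ r → Prime r × r ∣ q) ps
  ps∣q = All.zipWith (λ (p≢r , r-prime , r∣q*p) → r-prime , prime∣m*p⇒∣m p-prime r-prime (≢-sym p≢r) r∣q*p)
                     (p∉ps , ps∣q*p)
  2^length≤q : 2 ^ length ps ≤ q
  2^length≤q = distinctPrimeDivisors⇒2^length≤ (1≤m*n⇒1≤m q 1≤q*p) unique ps∣q

primeDivisorsOfTerms-length≤ : ∀ (u : ℕ → ℕ) {K} .{{_ : NonZero K}} →
  (∀ k → 0 < u (suc k)) → (∀ k → u k ≤ K ^ k) →
  ∀ Y {ps} → Unique ps → All (λ p → Prime p × ∃[ ℓ ] 1 ≤ ℓ × ℓ ≤ Y × p ∣ u ℓ) ps →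
  length ps ≤ K * (Y * Y)
primeDivisorsOfTerms-length≤ u {K} u>0 u≤K^ Y {ps} unique ps∣terms = 2^-cancel-≤ (begin
  2 ^ length ps                     ≤⟨ distinctPrimeDivisors⇒2^length≤ (>-nonZero⁻¹ P) unique (All.map divides-P ps∣terms) ⟩
  P                                 ≤⟨ product≤^length (map⁺ (applyUpTo⁺₁ suc Y terms≤K^Y)) ⟩
  (K ^ Y) ^ length terms            ≡⟨ cong ((K ^ Y) ^_) (trans (length-map u (applyUpTo suc Y)) (length-applyUpTo suc Y)) ⟩
  (K ^ Y) ^ Y                       ≡⟨ ^-*-assoc K Y Y ⟩
  K ^ (Y * Y)                       ≤⟨ ^-monoˡ-≤ (Y * Y) (<⇒≤ (n<2^n K)) ⟩
  (2 ^ K) ^ (Y * Y)                 ≡⟨ ^-*-assoc 2 K (Y * Y) ⟩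
  2 ^ (K * (Y * Y))                 ∎)
  where
  open ≤-Reasoning
  terms : List ℕ
  terms = map u (applyUpTo suc Y)
  P : ℕ
  P = product terms
  instance
    P≢0 : NonZero P
    P≢0 = product≢0 (map⁺ (applyUpTo⁺₂ suc Y (λ k → >-nonZero (u>0 k))))
  terms≤K^Y : ∀ {j} → j < Y → u (suc j) ≤ K ^ Y
  terms≤K^Y {j} j<Y = ≤-trans (u≤K^ (suc j)) (^-monoʳ-≤ K j<Y)
  divides-P : ∀ {p} → Prime p × ∃[ ℓ ] 1 ≤ ℓ × ℓ ≤ Y × p ∣ u ℓ → Prime p × p ∣ P
  divides-P (p-prime , suc j , _ , j<Y , p∣u[1+j]) =
    p-prime , ∣-trans p∣u[1+j] (∈⇒∣product (∈-map⁺ u (∈-applyUpTo⁺ suc j<Y)))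

lemma9 : (d : ℕ) → 1 < d → SquareFree d → (ε : OK) → IsFundamentalUnit d ε →
    ∃[ C ] ((y : ℕ) → 1 ≤ y → (ps : List ℕ) → Unique ps →
      All (λ p → Inert d p × EllAtMost d ε p y) ps →
      length ps ≤ C * (y * y))
lemma9 d 1<d _ ε (ε-unit , ε>1 , _) =
  suc (∣ traceK ε ∣ ℕ.+ ∣ im ε ∣) , λ y _ ps unique ps-inert →
    primeDivisorsOfTerms-length≤ (λ k → ∣ im (powK d ε k) ∣)
      (∣im-powK∣>0 1<d ε ε-unit ε>1) (∣im-powK∣≤^ 1<d ε ε-unit ε>1) y unique (All.map ω-part-divisible ps-inert)
  where
  open QuadraticOrder d
  ω-part-divisible : ∀ {p y} → Inert d p × EllAtMost d ε p y →
    Prime p × ∃[ ℓ ] 1 ≤ ℓ × ℓ ≤ y × p ∣ ∣ im (powK d ε ℓ) ∣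
  ω-part-divisible ((p-prime , _) , ℓ , (1≤ℓ , ε^ℓ∈ℤ+pO , _) , ℓ≤y) =
    p-prime , ℓ , 1≤ℓ , ℓ≤y , InZplusfOK⇒f∣∣im∣ ε^ℓ∈ℤ+pO
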